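{- Let $G$ be a simple connected plane graph and let $D=m(G)$ be its medial graph. Then the number of components of any link represented by the link graph $D$ (equivalently, the number of straight-ahead circuits of $D$) equals the number of connected components of the graph of angles $\mathcal{A}(G)$.
   Context: The medial graph $m(G)$ of a plane graph $G$ is the $4$-regular plane graph whose vertices correspond to the edges of $G$ (placed at their midpoints), with an edge joining two of these vertices for each pair of edges of $G$ that are consecutive on the boundary of a common face of $G$. In a $4$-regular plane graph, a straight-ahead circuit is a closed walk that at each vertex leaves along the edge not adjacent (in the cyclic order at that vertex) to the edge by which it entered; the components of a link represented by a $4$-regular plane graph (viewed as a link shadow) correspond to these circuits. An angle of $G$ is a pair $(v,F)$ where $v$ is a vertex of $G$ and $F$ is a face of $G$ containing $v$. Two angles $(v_1,F_1)$ and $(v_2,F_2)$ are adjacent if $v_1,v_2$ are joined by an edge $e$ of $G$ with $e = F_1\cap F_2$, i.e. $F_1$ and $F_2$ are the faces on the two sides of $e$. The graph of angles $\mathcal{A}(G)$ has the angles of $G$ as vertices and edges joining adjacent angles; it is $2$-regular, hence a disjoint union of circuits. -}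

module Defs where

open import Data.Nat using (ℕ; zero; suc; _+_)
open import Data.Fin using (Fin)
open import Data.Bool using (Bool; true; false; not)
open import Data.Product using (Σ; ∃; _×_; _,_)
open import Data.Sum using (_⊎_)
open import Data.Fin.Permutation using (Permutation′; _⟨$⟩ʳ_; _⟨$⟩ˡ_)
open import Function.Bundles using (_⇔_)
open import Function.Definitions using (Surjective)
open import Relation.Binary.PropositionalEquality using (_≡_)
open import Relation.Binary.Construct.Closure.Equivalence using (EqClosure)
open import Relation.Nullary using (¬_)

NumClasses : (X : Set) → (X → X → Set) → ℕ → Set
NumClasses X R k =
  Σ (X → Fin k) λ f → Surjective _≡_ _≡_ f × (∀ x y → (f x ≡ f y) ⇔ EqClosure R x y)

iter : {X : Set} → (X → X) → ℕ → X → X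
iter f zero    x = x
iter f (suc k) x = f (iter f k x)

SameOrbit : {X : Set} → (X → X) → X → X → Set
SameOrbit f x y = ∃ λ k → iter f k x ≡ y

-- Darts (half-edges) are Fin n; α pairs the two darts of an edge,
-- σ is the cyclic (say anticlockwise) rotation of darts around their vertex.
-- Vertices = σ-orbits, edges = α-orbits, faces = φ-orbits with φ = σ ∘ α.

record CMap : Set where
  field
    n     : ℕ
    σ     : Permutation′ n
    α     : Fin n → Fin n
    α-inv : ∀ d → α (α d) ≡ d
    α-fpf : ∀ d → ¬ (α d ≡ d)

  σ⁺ : Fin n → Fin n
  σ⁺ d = σ ⟨$⟩ʳ d

  σ⁻ : Fin n → Fin n
  σ⁻ d = σ ⟨$⟩ˡ d

  φ : Fin n → Fin n
  φ d = σ⁺ (α d)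

  φ⁻ : Fin n → Fin n
  φ⁻ d = α (σ⁻ d)

  SameVertex : Fin n → Fin n → Set
  SameVertex = SameOrbit σ⁺

  SameFace : Fin n → Fin n → Set
  SameFace = SameOrbit φ

  #Vertices : ℕ → Set
  #Vertices = NumClasses (Fin n) (λ x y → σ⁺ x ≡ y)

  #Edges : ℕ → Set
  #Edges = NumClasses (Fin n) (λ x y → α x ≡ y)

  #Faces : ℕ → Set
  #Faces = NumClasses (Fin n) (λ x y → φ x ≡ y)

open CMap public

Connected : CMap → Set
Connected M = NumClasses (Fin (n M)) (λ x y → (σ⁺ M x ≡ y) ⊎ (α M x ≡ y)) 1

-- plane (genus 0), for a connected map: Euler's formula V - E + F = 2
Plane : CMap → Set
Plane M = ∀ V E F → #Vertices M V → #Edges M E → #Faces M F → V + F ≡ E + 2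

-- simple: no loops and no multiple edges
Simple : CMap → Set
Simple M =
  (∀ d → ¬ SameVertex M d (α M d)) ×
  (∀ d d′ → SameVertex M d d′ → SameVertex M (α M d) (α M d′) → d ≡ d′)

record RotSys (X : Set) : Set where
  field
    rot  : X → X
    opp  : X → X

-- Straight-ahead step in a 4-regular graph: travel along the edge of dart x
-- to the dart opp x, then leave by the dart opposite to it, rot (rot (opp x)).
-- Straight-ahead circuits (unoriented) are the classes of the equivalence
-- relation generated by this step together with reversal of direction (opp).
StraightAhead : {X : Set} → RotSys X → X → X → Set
StraightAhead R x y = (RotSys.rot R (RotSys.rot R (RotSys.opp R x)) ≡ y) ⊎ (RotSys.opp R x ≡ y)

#StraightAheadCircuits : {X : Set} → RotSys X → ℕ → Set
#StraightAheadCircuits {X} R = NumClasses X (StraightAhead R)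

-- Medial vertices = edges of G (α-orbits).  Medial edges = pairs of edges of G
-- consecutive on a face boundary; these are indexed by the darts d of G:
-- medial edge d joins edge(d) and edge(φ d) (consecutive in the face of d).
-- A medial dart is (d , false) (end of medial edge d at edge(d)) or
-- (d , true) (end at edge(φ d)).  Around the midpoint of the edge {d, α d}
-- the four medial half-edges in cyclic order are
--   (d , false), (φ⁻ (α d) , true), (α d , false), (φ⁻ d , true).


MedialDart : CMap → Set
MedialDart M = Fin (n M) × Bool

medialGraph : (M : CMap) → RotSys (MedialDart M)
medialGraph M = record { rot = rot′ ; opp = opp′ }
  where
  rot′ : MedialDart M → MedialDart M
  rot′ (x , false) = (φ⁻ M (α M x) , true)
  rot′ (y , true)  = (φ M y , false)
  opp′ : MedialDart M → MedialDart M
  opp′ (x , b) = (x , not b)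

-- An angle (v , F) is represented by any dart d with vertex v and face F
-- (every incidence of a vertex v with a face F is realised by such a dart);
-- two darts represent the same angle iff they have the same vertex and face.

SameAngle : (M : CMap) → Fin (n M) → Fin (n M) → Set
SameAngle M a b = SameVertex M a b × SameFace M a b

-- Angles (v₁,F₁) ∋ a and (v₂,F₂) ∋ b are adjacent iff there is an edge
-- e = {d , α d} with v₁ = vertex(d), v₂ = vertex(α d) and {F₁,F₂} the faces
-- on the two sides of e, namely face(d) and face(α d).
AdjacentAngles : (M : CMap) → Fin (n M) → Fin (n M) → Set
AdjacentAngles M a b = ∃ λ d →
  SameVertex M d a × SameVertex M (α M d) b ×
  ((SameFace M d a × SameFace M (α M d) b) ⊎ (SameFace M (α M d) a × SameFace M d b))

#AngleComponents : CMap → ℕ → Set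
#AngleComponents M =
  NumClasses (Fin (n M)) (λ a b → SameAngle M a b ⊎ AdjacentAngles M a b)

-- A dart c of G stands for the angle (vertex of c, face of c). The medial edge of d runs
-- through the angle at φ d, and a straight-ahead step of m(G) crosses an edge {d, α d} of G
-- diagonally: between the angles at d and α d, or between those at σ d and σ (α d). So the
-- straight-ahead circuits are the classes of darts generated by these two local adjacencies,
-- and it remains to show that darts a ≠ b with the same vertex and the same face are already
-- joined by them. Splitting the vertex between a and b also splits the face; by Euler's formula
-- and the genus bound V + F + E ≤ #darts + 2 · #components this disconnects the map. A parity
-- count on the alternating α/β-cycles before and after the split then shows that a and b lie
-- on a common one.
module Submission where

open import Algebra.Definitions using (Involutive)
open import Data.Bool using (false; true)
open import Data.Empty using (⊥-elim)
open import Data.Fin using (Fin; zero; suc; toℕ; punchIn; punchOut)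
open import Data.Fin.Permutation using (inverseˡ; inverseʳ)
open import Data.Fin.Permutation.Components using (transpose)
open import Data.Fin.Properties
  using (_≟_; any?; suc-injective; pigeonhole; injective⇒≤;
         punchInᵢ≢i; punchOut-cong; punchOut-injective; punchOut-punchIn)
open import Data.List using (List; []; _∷_; _++_; map; allFin)
open import Data.List.Membership.Propositional using (_∈_)
open import Data.List.Membership.Propositional.Properties
  using (∈-allFin; ∈-map⁺; ∈-map⁻; ∈-++⁺ˡ; ∈-++⁺ʳ; ∈-++⁻)
open import Data.List.Relation.Unary.Any using (toSum; fromSum)
open import Data.Nat using (ℕ; zero; suc; _+_; _*_; _∸_; _≤_; _<_; _≰_; z≤n; s≤s; z<s)
open import Data.Nat.Divisibility using (_∣_; divides; ∣m+n∣m⇒∣n; ∣1⇒≡1)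
open import Data.Nat.Induction using (<-wellFounded)
open import Data.Nat.Properties
  using (+-assoc; +-comm; +-suc; +-identityʳ; +-cancelʳ-≡; *-comm; *-suc;
         +-monoˡ-≤; +-monoʳ-≤; +-monoʳ-<; ≤-refl; ≤-reflexive; ≤-trans; ≤-antisym; ≤-pred;
         <⇒≤; <⇒≱; n<1+n; m≤n⇒m≤1+n; m≤n⇒m<n∨m≡n; m+[n∸m]≡n; m∸n+n≡m; ∸-monoʳ-<;
         module ≤-Reasoning)
open import Data.Nat.Solver using (module +-*-Solver)
open import Data.Product using (∃; ∃-syntax; _×_; _,_; proj₁; proj₂; curry)
open import Data.Sum using (_⊎_; inj₁; inj₂; [_,_]′; map₂)
open import Function using (_∘_; id; _⇔_; mk⇔; Injective; Surjective; _on_)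
open import Function.Bundles using (module Equivalence)
open import Function.Construct.Composition using (_⇔-∘_)
open import Function.Properties.Equivalence using (⇔-isEquivalence)
open import Induction.WellFounded using (module All)
open import Level using (0ℓ)
open import Relation.Binary.Core using (Rel; _⇒_)
open import Relation.Binary.Construct.Closure.Equivalence as EqClosure
  using (EqClosure; return; symmetric; fold; gfold; _⋆)
open import Relation.Binary.Construct.Closure.ReflexiveTransitive using (ε; _◅◅_)
open import Relation.Binary.Construct.On using (wellFounded)
open import Relation.Binary.Construct.Union using (_∪_)
open import Relation.Binary.PropositionalEquality
open import Relation.Binary.Structures using (IsEquivalence)
open import Relation.Nullary using (¬_; Dec; yes; no; contradiction)
open import Relation.Nullary.Decidable using (map′; ¬?; _⊎-dec_; _×-dec_; decidable-stable)
open import Relation.Unary using (Pred; Decidable; _⊆_)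

open import Defs hiding (n)

open Equivalence using (to; from)
open +-*-Solver using (solve; _:+_; _:=_; con)

private variable
  X Y : Set
  R S : Rel X 0ℓ
  u v : X
  k k′ n : ℕ

Edge : X → X → Rel X 0ℓ
Edge u v x y = (x , y) ≡ (u , v)

numClasses-cong : R ⇒ EqClosure S → S ⇒ EqClosure R → NumClasses X R k → NumClasses X S k
numClasses-cong R⇒S S⇒R (f , surj , fibres) =
  f , surj , λ x y → mk⇔ ((R⇒S ⋆) ∘ to (fibres x y)) (from (fibres x y) ∘ (S⇒R ⋆))

numClasses-mono : R ⇒ EqClosure S → NumClasses X R k → NumClasses X S k′ → k′ ≤ k
numClasses-mono R⇒S (f , _ , f-fibres) (g , g-surj , g-fibres) = injective⇒≤ representative-injective
  where
  representative : Fin _ → _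
  representative i = proj₁ (g-surj i)
  g-representative : ∀ i → g (representative i) ≡ i
  g-representative i = proj₂ (g-surj i) refl
  representative-injective : Injective _≡_ _≡_ (f ∘ representative)
  representative-injective {i} {j} e = begin
    i                     ≡⟨ g-representative i ⟨
    g (representative i)  ≡⟨ from (g-fibres _ _) ((R⇒S ⋆) (to (f-fibres _ _) e)) ⟩
    g (representative j)  ≡⟨ g-representative j ⟩
    j                     ∎
    where open ≡-Reasoning

numClasses-unique : NumClasses X R k → NumClasses X R k′ → k ≡ k′
numClasses-unique N N′ = ≤-antisym (numClasses-mono return N′ N) (numClasses-mono return N N′)

numClasses-≡ : R ⇒ EqClosure S → S ⇒ EqClosure R → NumClasses X R k → NumClasses X S k′ → k ≡ k′
numClasses-≡ R⇒S S⇒R N = numClasses-unique (numClasses-cong R⇒S S⇒R N)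

eqClosure? : NumClasses X R k → ∀ x y → Dec (EqClosure R x y)
eqClosure? (f , _ , fibres) x y = map′ (to (fibres x y)) (from (fibres x y)) (f x ≟ f y)

numClasses-discrete : {R : Rel (Fin n) 0ℓ} → R ⇒ _≡_ → NumClasses (Fin n) R n
numClasses-discrete R⇒≡ =
  id , (λ i → i , λ { refl → refl }) , λ x y → mk⇔ (λ { refl → ε }) (gfold isEquivalence id R⇒≡)

numClasses-addEdge : NumClasses X R k → EqClosure R u v → NumClasses X (Edge u v ∪ R) k
numClasses-addEdge {R = R} {u = u} {v} (f , surj , fibres) u~v =
  f , surj , λ x y → mk⇔ ((return ∘ inj₂) ⋆ ∘ to (fibres x y)) (gfold isEquivalence f respects)
  where
  respects : Edge u v ∪ R ⇒ (_≡_ on f)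
  respects (inj₁ refl) = from (fibres u v) u~v
  respects (inj₂ r)    = from (fibres _ _) (return r)

absorbEdge : EqClosure R u v → Edge u v ∪ R ⇒ EqClosure R
absorbEdge u~v (inj₁ refl) = u~v
absorbEdge u~v (inj₂ r)    = return r

module _ {k : ℕ} {i j : Fin (suc k)} (i≢j : i ≢ j) where

  redirect : Fin (suc k) → Fin (suc k)
  redirect m with m ≟ j
  ... | yes _ = i
  ... | no _  = m

  j≢redirect : ∀ m → j ≢ redirect m
  j≢redirect m with m ≟ j
  ... | yes _   = i≢j ∘ sym
  ... | no m≢j  = m≢j ∘ sym

  redirect-punchIn : ∀ t → redirect (punchIn j t) ≡ punchIn j t
  redirect-punchIn t with punchIn j t ≟ j
  ... | yes e = contradiction e (punchInᵢ≢i j t)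
  ... | no _  = refl

  redirect-i : redirect i ≡ i
  redirect-i with i ≟ j
  ... | yes i≡j = contradiction i≡j i≢j
  ... | no _    = refl

  redirect-j : redirect j ≡ i
  redirect-j with j ≟ j
  ... | yes _  = refl
  ... | no j≢j = contradiction refl j≢j

  collapse : Fin (suc k) → Fin k
  collapse m = punchOut (j≢redirect m)

  collapse-punchIn : ∀ t → collapse (punchIn j t) ≡ t
  collapse-punchIn t = trans (punchOut-cong j (redirect-punchIn t)) (punchOut-punchIn j)

  collapse-i≡collapse-j : collapse i ≡ collapse j
  collapse-i≡collapse-j = punchOut-cong j (trans redirect-i (sym redirect-j))

  collapse-injective : ∀ a b → collapse a ≡ collapse b → redirect a ≡ redirect b
  collapse-injective a b = punchOut-injective (j≢redirect a) (j≢redirect b)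

numClasses-addEdge-merging : NumClasses X R k → ¬ EqClosure R u v →
  ∃[ k′ ] k ≡ suc k′ × NumClasses X (Edge u v ∪ R) k′
numClasses-addEdge-merging {k = zero} {u = u} (f , _) _ with f u
... | ()
numClasses-addEdge-merging {X = X} {R = R} {k = suc k} {u = u} {v} (f , surj , fibres) u≁v =
  k , refl , collapse fu≢fv ∘ f , merged-surjective ,
  λ x y → mk⇔ (merged-related x y) (gfold isEquivalence _ respects)
  where
  R⁺ : Rel X 0ℓ
  R⁺ = Edge u v ∪ R
  fu≢fv : f u ≢ f v
  fu≢fv = u≁v ∘ to (fibres u v)
  lift : ∀ {x y} → f x ≡ f y → EqClosure R⁺ x y
  lift = (return ∘ inj₂) ⋆ ∘ to (fibres _ _)
  merged-surjective : Surjective _≡_ _≡_ (collapse fu≢fv ∘ f)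
  merged-surjective t =
    x , λ { refl → trans (cong (collapse fu≢fv) (proj₂ (surj _) refl)) (collapse-punchIn fu≢fv t) }
    where x = proj₁ (surj (punchIn (f v) t))
  respects : R⁺ ⇒ (_≡_ on (collapse fu≢fv ∘ f))
  respects (inj₁ refl) = collapse-i≡collapse-j fu≢fv
  respects (inj₂ r)    = cong (collapse fu≢fv) (from (fibres _ _) (return r))
  representative : ∀ x → ∃[ x̂ ] f x̂ ≡ redirect fu≢fv (f x) × EqClosure R⁺ x x̂
  representative x with f x ≟ f v
  ... | yes fx≡fv = u , refl , lift fx≡fv ◅◅ symmetric _ (return (inj₁ refl))
  ... | no _      = x , refl , ε
  merged-related : ∀ x y → collapse fu≢fv (f x) ≡ collapse fu≢fv (f y) → EqClosure R⁺ x y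
  merged-related x y e with representative x | representative y
  ... | x̂ , fx̂ , x~x̂ | ŷ , fŷ , y~ŷ =
    x~x̂ ◅◅ lift (trans fx̂ (trans (collapse-injective fu≢fv (f x) (f y) e) (sym fŷ))) ◅◅ symmetric _ y~ŷ

numClasses-transfer : {R : Rel X 0ℓ} {S : Rel Y 0ℓ} (p : X → Y) (s : Y → X) → (∀ y → p (s y) ≡ y) →
  (∀ u v → EqClosure R u v ⇔ EqClosure S (p u) (p v)) → ∀ k → NumClasses X R k ⇔ NumClasses Y S k
numClasses-transfer {S = S} p s ps≗id R⇔S k = mk⇔ forth back
  where
  forth : NumClasses _ _ k → NumClasses _ _ k
  forth (f , surj , fibres) = f ∘ s , surj′ , fibres′
    where
    surj′ : Surjective _≡_ _≡_ (f ∘ s)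
    surj′ i = p x , λ { refl → trans (from (fibres _ _) (from (R⇔S _ _) psp~p)) (proj₂ (surj i) refl) }
      where
      x = proj₁ (surj i)
      psp~p : EqClosure S (p (s (p x))) (p x)
      psp~p = subst (λ t → EqClosure S t (p x)) (sym (ps≗id _)) ε
    fibres′ : ∀ y y′ → (f (s y) ≡ f (s y′)) ⇔ EqClosure S y y′
    fibres′ y y′ = mk⇔
      (subst₂ (EqClosure S) (ps≗id y) (ps≗id y′) ∘ to (R⇔S _ _) ∘ to (fibres _ _))
      (from (fibres _ _) ∘ from (R⇔S _ _) ∘ subst₂ (EqClosure S) (sym (ps≗id y)) (sym (ps≗id y′)))
  back : NumClasses _ _ k → NumClasses _ _ k
  back (f , surj , fibres) =
    f ∘ p , surj′ , λ u v → mk⇔ (from (R⇔S u v) ∘ to (fibres _ _)) (from (fibres _ _) ∘ to (R⇔S u v))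
    where
    surj′ : Surjective _≡_ _≡_ (f ∘ p)
    surj′ i = s (proj₁ (surj i)) , λ { refl → trans (cong f (ps≗id _)) (proj₂ (surj i) refl) }

Edges : List (X × X) → Rel X 0ℓ
Edges L x y = (x , y) ∈ L

numClasses-edges : (L : List (Fin n × Fin n)) → ∃ (NumClasses (Fin n) (Edges L))
numClasses-edges {n} [] = n , numClasses-discrete λ ()
numClasses-edges ((u , v) ∷ L) with numClasses-edges L
... | k , N with eqClosure? N u v
...   | yes u~v = k , numClasses-cong (return ∘ fromSum) (return ∘ toSum) (numClasses-addEdge N u~v)
...   | no u≁v with numClasses-addEdge-merging N u≁v
...     | k′ , _ , N′ = k′ , numClasses-cong (return ∘ fromSum) (return ∘ toSum) N′

Graph : (X → X) → Rel X 0ℓ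
Graph f x y = f x ≡ y

graphEdges : (Fin n → Fin n) → List (Fin n × Fin n)
graphEdges f = map (λ x → x , f x) (allFin _)

module _ {f : Fin n → Fin n} where

  graph⇒graphEdges : Graph f ⇒ Edges (graphEdges f)
  graph⇒graphEdges {x} refl = ∈-map⁺ _ (∈-allFin x)

  graphEdges⇒graph : Edges (graphEdges f) ⇒ Graph f
  graphEdges⇒graph e with ∈-map⁻ _ e
  ... | _ , _ , refl = refl

#cycles : (Fin n → Fin n) → ℕ
#cycles π = proj₁ (numClasses-edges (graphEdges π))

cycles : (π : Fin n → Fin n) → NumClasses (Fin n) (Graph π) (#cycles π)
cycles π =
  numClasses-cong (return ∘ graphEdges⇒graph) (return ∘ graph⇒graphEdges) (proj₂ (numClasses-edges _))

#orbits : (Fin n → Fin n) → (Fin n → Fin n) → ℕ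
#orbits π α = proj₁ (numClasses-edges (graphEdges π ++ graphEdges α))

orbits : (π α : Fin n → Fin n) → NumClasses (Fin n) (Graph π ∪ Graph α) (#orbits π α)
orbits π α = numClasses-cong (return ∘ fromEdges) (return ∘ toEdges) (proj₂ (numClasses-edges _))
  where
  fromEdges : Edges (graphEdges π ++ graphEdges α) ⇒ Graph π ∪ Graph α
  fromEdges e with ∈-++⁻ (graphEdges π) e
  ... | inj₁ e′ = inj₁ (graphEdges⇒graph e′)
  ... | inj₂ e′ = inj₂ (graphEdges⇒graph e′)
  toEdges : Graph π ∪ Graph α ⇒ Edges (graphEdges π ++ graphEdges α)
  toEdges (inj₁ e) = ∈-++⁺ˡ (graph⇒graphEdges e)
  toEdges (inj₂ e) = ∈-++⁺ʳ (graphEdges π) (graph⇒graphEdges e)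

#cycles-cong : {π π′ : Fin n → Fin n} → π ≗ π′ → #cycles π ≡ #cycles π′
#cycles-cong π≗π′ =
  numClasses-≡ (λ { refl → return (sym (π≗π′ _)) }) (λ { refl → return (π≗π′ _) }) (cycles _) (cycles _)

module _ (f : X → X) where

  iter-+ : ∀ i j x → iter f (i + j) x ≡ iter f i (iter f j x)
  iter-+ zero    j x = refl
  iter-+ (suc i) j x = cong f (iter-+ i j x)

  iter-fixed : ∀ {x} → f x ≡ x → ∀ k → iter f k x ≡ x
  iter-fixed fx≡x zero    = refl
  iter-fixed fx≡x (suc k) = trans (cong f (iter-fixed fx≡x k)) fx≡x

  iter-injective : Injective _≡_ _≡_ f → ∀ k → Injective _≡_ _≡_ (iter f k)
  iter-injective f-inj zero    = id
  iter-injective f-inj (suc k) = iter-injective f-inj k ∘ f-inj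

  sameOrbit-trans : ∀ {x y z} → SameOrbit f x y → SameOrbit f y z → SameOrbit f x z
  sameOrbit-trans (i , refl) (j , refl) = j + i , iter-+ j i _

  sameOrbit⇒eqClosure : ∀ {x y} → SameOrbit f x y → EqClosure (Graph f) x y
  sameOrbit⇒eqClosure (zero  , refl) = ε
  sameOrbit⇒eqClosure (suc k , refl) = sameOrbit⇒eqClosure (k , refl) ◅◅ return refl

module _ {f : Fin n → Fin n} (f-injective : Injective _≡_ _≡_ f) where

  iter-periodic : ∀ x → ∃[ m ] iter f (suc m) x ≡ x
  iter-periodic x with pigeonhole (n<1+n _) (λ i → iter f (toℕ i) x)
  ... | i , j , i<j , fⁱx≡fʲx = m , iter-injective f f-injective (toℕ i) (begin
      iter f (toℕ i) (iter f (suc m) x) ≡⟨ iter-+ f (toℕ i) (suc m) x ⟨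
      iter f (toℕ i + suc m) x          ≡⟨ cong (λ t → iter f t x) (trans (+-suc (toℕ i) m) (m+[n∸m]≡n i<j)) ⟩
      iter f (toℕ j) x                  ≡⟨ fⁱx≡fʲx ⟨
      iter f (toℕ i) x                  ∎)
    where
    open ≡-Reasoning
    m = toℕ j ∸ suc (toℕ i)

  sameOrbit-sym : ∀ {x y} → SameOrbit f x y → SameOrbit f y x
  sameOrbit-sym {x} (k , refl) with iter-periodic x
  ... | m , fᵐ⁺¹x≡x = k * m , (begin
      iter f (k * m) (iter f k x) ≡⟨ iter-+ f (k * m) k x ⟨
      iter f (k * m + k) x        ≡⟨ cong (λ t → iter f t x) (trans (+-comm (k * m) k) (sym (*-suc k m))) ⟩
      iter f (k * suc m) x        ≡⟨ periodic k ⟩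
      x                           ∎)
    where
    open ≡-Reasoning
    periodic : ∀ l → iter f (l * suc m) x ≡ x
    periodic zero    = refl
    periodic (suc l) =
      trans (iter-+ f (suc m) (l * suc m) x) (trans (cong (iter f (suc m)) (periodic l)) fᵐ⁺¹x≡x)

  eqClosure⇒sameOrbit : ∀ {x y} → EqClosure (Graph f) x y → SameOrbit f x y
  eqClosure⇒sameOrbit = fold sameOrbit-isEquivalence (λ { refl → 1 , refl })
    where
    sameOrbit-isEquivalence : IsEquivalence (SameOrbit f)
    sameOrbit-isEquivalence = record
      { refl = 0 , refl ; sym = sameOrbit-sym ; trans = sameOrbit-trans f }

  sameOrbit-shift : ∀ {x y} → SameOrbit f x y → SameOrbit f (f x) y
  sameOrbit-shift = sameOrbit-trans f (sameOrbit-sym (1 , refl))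

fixed-isolated : {f : Fin n → Fin n} → Injective _≡_ _≡_ f →
  ∀ {x y} → f y ≡ y → EqClosure (Graph f) x y → x ≡ y
fixed-isolated {f = f} f-inj fy≡y x~y with eqClosure⇒sameOrbit f-inj (symmetric _ x~y)
... | k , fᵏy≡x = trans (sym fᵏy≡x) (iter-fixed f fy≡y k)

involutive⇒injective : {f : X → X} → Involutive _≡_ f → Injective _≡_ _≡_ f
involutive⇒injective {f = f} f-inv {a} {b} e = trans (sym (f-inv a)) (trans (cong f e) (f-inv b))

data TransposeView {n} (i j k : Fin n) : Fin n → Set where
  at-i      : k ≡ i → TransposeView i j k j
  at-j      : k ≢ i → k ≡ j → TransposeView i j k i
  elsewhere : k ≢ i → k ≢ j → TransposeView i j k k

transpose-view : (i j k : Fin n) → TransposeView i j k (transpose i j k)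
transpose-view i j k with k ≟ i
... | yes k≡i = at-i k≡i
... | no k≢i with k ≟ j
...   | yes k≡j = at-j k≢i k≡j
...   | no k≢j  = elsewhere k≢i k≢j

module _ (i j : Fin n) where

  transpose-i : transpose i j i ≡ j
  transpose-i with transpose i j i | transpose-view i j i
  ... | _ | at-i _          = refl
  ... | _ | at-j i≢i _      = contradiction refl i≢i
  ... | _ | elsewhere i≢i _ = contradiction refl i≢i

  transpose-j : transpose i j j ≡ i
  transpose-j with transpose i j j | transpose-view i j j
  ... | _ | at-i refl       = refl
  ... | _ | at-j _ _        = refl
  ... | _ | elsewhere _ j≢j = contradiction refl j≢j

  transpose-other : ∀ {k} → k ≢ i → k ≢ j → transpose i j k ≡ k
  transpose-other {k} k≢i k≢j with transpose i j k | transpose-view i j k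
  ... | _ | at-i k≡i      = contradiction k≡i k≢i
  ... | _ | at-j _ k≡j    = contradiction k≡j k≢j
  ... | _ | elsewhere _ _ = refl

  transpose-involutive : ∀ k → transpose i j (transpose i j k) ≡ k
  transpose-involutive k with transpose i j k | transpose-view i j k
  ... | _ | at-i refl         = transpose-j
  ... | _ | at-j _ refl       = transpose-i
  ... | _ | elsewhere k≢i k≢j = transpose-other k≢i k≢j

  transpose-injective : Injective _≡_ _≡_ (transpose i j)
  transpose-injective = involutive⇒injective {f = transpose i j} transpose-involutive

transpose-conjugate : {f : Fin n → Fin n} → Injective _≡_ _≡_ f →
  ∀ i j k → transpose (f i) (f j) (f k) ≡ f (transpose i j k)
transpose-conjugate {f = f} f-inj i j k with transpose i j k | transpose-view i j k
... | _ | at-i refl         = transpose-i (f i) (f j)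
... | _ | at-j _ refl       = transpose-j (f i) (f j)
... | _ | elsewhere k≢i k≢j = transpose-other (f i) (f j) (k≢i ∘ f-inj) (k≢j ∘ f-inj)

transpose-∘-involution : {α : Fin n → Fin n} → Involutive _≡_ α →
  ∀ x y → transpose x y ∘ α ≗ α ∘ transpose (α x) (α y)
transpose-∘-involution {α = α} α-inv x y z =
  subst₂ (λ p q → transpose p q (α z) ≡ α (transpose (α x) (α y) z)) (α-inv x) (α-inv y)
    (transpose-conjugate (involutive⇒injective {f = α} α-inv) (α x) (α y) z)

minimal : {P : ℕ → Set} → (∀ k → Dec (P k)) → ∀ {m} → P m → ∃[ j ] P j × (∀ {i} → i < j → ¬ P i)
minimal P? {zero} p = 0 , p , λ ()
minimal P? {suc m} p with P? 0
... | yes p₀ = 0 , p₀ , λ ()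
... | no ¬p₀ with minimal (P? ∘ suc) p
...   | j , pj , below = suc j , pj , λ { {zero} _ → ¬p₀ ; {suc i} (s≤s i<j) → below i<j }

module _ {π π′ : Fin n → Fin n} {x y : Fin n} (π′≗πτ : π′ ≗ π ∘ transpose x y) where

  graph-transpose : Graph π′ ⇒ EqClosure (Edge x y ∪ Graph π)
  graph-transpose {a} refl with transpose x y a | transpose-view x y a | π′≗πτ a
  ... | _ | at-i refl     | e = return (inj₁ refl) ◅◅ return (inj₂ (sym e))
  ... | _ | at-j _ refl   | e = symmetric _ (return (inj₁ refl)) ◅◅ return (inj₂ (sym e))
  ... | _ | elsewhere _ _ | e = return (inj₂ (sym e))

  transpose-back : π ≗ π′ ∘ transpose x y
  transpose-back z = trans (cong π (sym (transpose-involutive x y z))) (sym (π′≗πτ (transpose x y z)))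

  π′x≡πy : π′ x ≡ π y
  π′x≡πy = trans (π′≗πτ x) (cong π (transpose-i x y))

  π′y≡πx : π′ y ≡ π x
  π′y≡πx = trans (π′≗πτ y) (cong π (transpose-j x y))

  π′≡π-elsewhere : ∀ {z} → z ≢ x → z ≢ y → π′ z ≡ π z
  π′≡π-elsewhere z≢x z≢y = trans (π′≗πτ _) (cong π (transpose-other x y z≢x z≢y))

  π′-injective : Injective _≡_ _≡_ π → Injective _≡_ _≡_ π′
  π′-injective π-inj e = transpose-injective x y (π-inj (trans (sym (π′≗πτ _)) (trans e (π′≗πτ _))))

  -- The walk x, π y, π² y, … follows π′ until it reaches y.
  transpose-walk : ¬ EqClosure (Graph π) x y →
    ∀ j → EqClosure (Graph π′) x (iter π (suc j) y) ⊎ EqClosure (Graph π′) x y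
  transpose-walk x≁y zero = inj₁ (return π′x≡πy)
  transpose-walk x≁y (suc j) with transpose-walk x≁y j
  ... | inj₂ x~y = inj₂ x~y
  ... | inj₁ x~z with iter π (suc j) y ≟ y | iter π (suc j) y ≟ x
  ...   | yes z≡y | _       = inj₂ (subst (EqClosure (Graph π′) x) z≡y x~z)
  ...   | no _    | yes z≡x = contradiction (subst (λ t → EqClosure (Graph π) t y) z≡x y~z⁻¹) x≁y
    where y~z⁻¹ = symmetric _ (sameOrbit⇒eqClosure π (suc j , refl))
  ...   | no z≢y  | no z≢x  = inj₁ (x~z ◅◅ return (π′≡π-elsewhere z≢x z≢y))

  transpose-merges : Injective _≡_ _≡_ π → ¬ EqClosure (Graph π) x y → EqClosure (Graph π′) x y
  transpose-merges π-inj x≁y with iter-periodic π-inj y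
  ... | m , πᵐ⁺¹y≡y with transpose-walk x≁y m
  ...   | inj₁ x~πᵐ⁺¹y = subst (EqClosure (Graph π′) x) πᵐ⁺¹y≡y x~πᵐ⁺¹y
  ...   | inj₂ x~y     = x~y

  -- With j + 1 the least exponent taking x to y, the arc π x, …, πʲ⁺¹ x = y of the
  -- π-cycle is closed under π′ but misses x.
  module Arc (π-inj : Injective _≡_ _≡_ π) (j : ℕ) (πʲ⁺¹x≡y : iter π (suc j) x ≡ y)
             (first : ∀ {i} → i < suc j → iter π i x ≢ y) where

    Arc : Pred (Fin n) 0ℓ
    Arc z = ∃[ i ] i ≤ j × iter π (suc i) x ≡ z

    y∈Arc : Arc y
    y∈Arc = j , ≤-refl , πʲ⁺¹x≡y

    x∉Arc : ¬ Arc x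
    x∉Arc (i , i≤j , πⁱ⁺¹x≡x) = first (∸-monoʳ-< z<s (s≤s i≤j)) (begin
      iter π (j ∸ i) x                          ≡⟨ cong (iter π (j ∸ i)) πⁱ⁺¹x≡x ⟨
      iter π (j ∸ i) (iter π (suc i) x)         ≡⟨ iter-+ π (j ∸ i) (suc i) x ⟨
      iter π (j ∸ i + suc i) x                  ≡⟨ cong (λ t → iter π t x) (m∸n+n≡m (s≤s i≤j)) ⟩
      iter π (suc j) x                          ≡⟨ πʲ⁺¹x≡y ⟩
      y                                         ∎)
      where open ≡-Reasoning

    π′-along-arc : ∀ {i} → i < j → π′ (iter π (suc i) x) ≡ iter π (suc (suc i)) x
    π′-along-arc i<j = π′≡π-elsewhere (λ e → x∉Arc (_ , <⇒≤ i<j , e)) (first (s≤s i<j))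

    arc-closed : ∀ {z} → Arc z → Arc (π′ z)
    arc-closed (i , i≤j , refl) with m≤n⇒m<n∨m≡n i≤j
    ... | inj₁ i<j  = suc i , i<j , sym (π′-along-arc i<j)
    ... | inj₂ refl = 0 , z≤n , trans (sym π′y≡πx) (cong π′ (sym πʲ⁺¹x≡y))

    arc-coclosed : ∀ {z} → Arc (π′ z) → Arc z
    arc-coclosed (zero , _ , πx≡π′z) = subst Arc (π′-injective π-inj (trans π′y≡πx πx≡π′z)) y∈Arc
    arc-coclosed (suc i , i<j , e)    = i , <⇒≤ i<j , π′-injective π-inj (trans (π′-along-arc i<j) e)

    arc-invariant : ∀ {a b} → EqClosure (Graph π′) a b → Arc a ⇔ Arc b
    arc-invariant = gfold ⇔-isEquivalence Arc (λ { refl → mk⇔ arc-closed arc-coclosed })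

  transpose-splits : Injective _≡_ _≡_ π → SameOrbit π x y → x ≢ y → ¬ EqClosure (Graph π′) x y
  transpose-splits π-inj (k , πᵏx≡y) x≢y x~y with minimal (λ i → iter π i x ≟ y) {k} πᵏx≡y
  ... | zero  , x≡y     , _     = x≢y x≡y
  ... | suc j , πʲ⁺¹x≡y , first = x∉Arc (from (arc-invariant x~y) y∈Arc)
    where open Arc π-inj j πʲ⁺¹x≡y first

module _ {π π′ : Fin n → Fin n} {x y : Fin n} (π′≗πτ : π′ ≗ π ∘ transpose x y) where

  #cycles-transpose-merge : Injective _≡_ _≡_ π → ¬ EqClosure (Graph π) x y →
    #cycles π ≡ suc (#cycles π′)
  #cycles-transpose-merge π-inj x≁y with numClasses-addEdge-merging (cycles π) x≁y
  ... | k , #π≡1+k , N =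
    trans #π≡1+k (cong suc (numClasses-≡ merged⇒π′ (graph-transpose π′≗πτ) N (cycles π′)))
    where
    x~′y : EqClosure (Graph π′) x y
    x~′y = transpose-merges π′≗πτ π-inj x≁y
    merged⇒π′ : Edge x y ∪ Graph π ⇒ EqClosure (Graph π′)
    merged⇒π′ (inj₁ refl) = x~′y
    merged⇒π′ (inj₂ e)    = (absorbEdge x~′y ⋆) (graph-transpose (transpose-back π′≗πτ) e)

  #cycles-transpose-≤ : #cycles π ≤ suc (#cycles π′)
  #cycles-transpose-≤ with eqClosure? (cycles π) x y
  ... | yes x~y =
    m≤n⇒m≤1+n (numClasses-mono (graph-transpose π′≗πτ) (cycles π′) (numClasses-addEdge (cycles π) x~y))
  ... | no x≁y with numClasses-addEdge-merging (cycles π) x≁y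
  ...   | k , #π≡1+k , N =
    ≤-trans (≤-reflexive #π≡1+k) (s≤s (numClasses-mono (graph-transpose π′≗πτ) (cycles π′) N))

#cycles-transpose-split : {π π′ : Fin n → Fin n} {x y : Fin n} → π′ ≗ π ∘ transpose x y →
  Injective _≡_ _≡_ π → SameOrbit π x y → x ≢ y → #cycles π′ ≡ suc (#cycles π)
#cycles-transpose-split π′≗πτ π-inj x~y x≢y =
  #cycles-transpose-merge (transpose-back π′≗πτ) (π′-injective π′≗πτ π-inj)
    (transpose-splits π′≗πτ π-inj x~y x≢y)

module _ {π π′ : Fin n → Fin n} {x y : Fin n} (π′≗πτ : π′ ≗ π ∘ transpose x y)
         (α : Fin n → Fin n) where

  orbits-transpose : Graph π′ ∪ Graph α ⇒ EqClosure (Edge x y ∪ (Graph π ∪ Graph α))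
  orbits-transpose (inj₁ e) = EqClosure.map (map₂ inj₁) (graph-transpose π′≗πτ e)
  orbits-transpose (inj₂ e) = return (inj₂ (inj₂ e))

count : {P : Pred (Fin n) 0ℓ} → Decidable P → ℕ
count {zero}  P? = 0
count {suc n} P? with P? zero
... | yes _ = suc (count (P? ∘ suc))
... | no _  = count (P? ∘ suc)

count-cong : {P Q : Pred (Fin n) 0ℓ} (P? : Decidable P) (Q? : Decidable Q) →
  P ⊆ Q → Q ⊆ P → count P? ≡ count Q?
count-cong {zero}  P? Q? P⊆Q Q⊆P = refl
count-cong {suc n} P? Q? P⊆Q Q⊆P with P? zero | Q? zero
... | yes _ | yes _  = cong suc (count-cong (P? ∘ suc) (Q? ∘ suc) P⊆Q Q⊆P)
... | no _  | no _   = count-cong (P? ∘ suc) (Q? ∘ suc) P⊆Q Q⊆P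
... | yes p | no ¬q  = contradiction (P⊆Q p) ¬q
... | no ¬p | yes q  = contradiction (Q⊆P q) ¬p

count-mono : {P Q : Pred (Fin n) 0ℓ} (P? : Decidable P) (Q? : Decidable Q) →
  P ⊆ Q → count P? ≤ count Q?
count-mono {zero}  P? Q? P⊆Q = z≤n
count-mono {suc n} P? Q? P⊆Q with P? zero | Q? zero
... | yes _ | yes _  = s≤s (count-mono (P? ∘ suc) (Q? ∘ suc) P⊆Q)
... | no _  | no _   = count-mono (P? ∘ suc) (Q? ∘ suc) P⊆Q
... | yes p | no ¬q  = contradiction (P⊆Q p) ¬q
... | no _  | yes _  = m≤n⇒m≤1+n (count-mono (P? ∘ suc) (Q? ∘ suc) P⊆Q)

count-strict : {P Q : Pred (Fin n) 0ℓ} (P? : Decidable P) (Q? : Decidable Q) →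
  P ⊆ Q → ∀ {a} → Q a → ¬ P a → count P? < count Q?
count-strict {suc n} P? Q? P⊆Q {a} Qa ¬Pa with P? zero | Q? zero | a
... | yes p | no ¬q | _     = contradiction (P⊆Q p) ¬q
... | yes p | yes _ | zero  = contradiction p ¬Pa
... | no _  | no ¬q | zero  = contradiction Qa ¬q
... | no _  | yes _ | zero  = s≤s (count-mono (P? ∘ suc) (Q? ∘ suc) P⊆Q)
... | yes _ | yes _ | suc a = s≤s (count-strict (P? ∘ suc) (Q? ∘ suc) P⊆Q Qa ¬Pa)
... | no _  | yes _ | suc a = m≤n⇒m≤1+n (count-strict (P? ∘ suc) (Q? ∘ suc) P⊆Q Qa ¬Pa)
... | no _  | no _  | suc a = count-strict (P? ∘ suc) (Q? ∘ suc) P⊆Q Qa ¬Pa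

count-insert : {P Q : Pred (Fin n) 0ℓ} (P? : Decidable P) (Q? : Decidable Q) →
  P ⊆ Q → ∀ {a} → Q a → ¬ P a → (∀ {x} → Q x → P x ⊎ x ≡ a) → count Q? ≡ suc (count P?)
count-insert {suc n} P? Q? P⊆Q {a} Qa ¬Pa Q⊆P+a with P? zero | Q? zero | a
... | yes p | no ¬q | _     = contradiction (P⊆Q p) ¬q
... | yes p | yes _ | zero  = contradiction p ¬Pa
... | no _  | no ¬q | zero  = contradiction Qa ¬q
... | no _  | yes _ | zero  = cong suc (count-cong (Q? ∘ suc) (P? ∘ suc) (λ q → [ id , (λ ()) ]′ (Q⊆P+a q)) P⊆Q)
... | no ¬p | yes q | suc a = ⊥-elim ([ ¬p , (λ ()) ]′ (Q⊆P+a q))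
... | yes _ | yes _ | suc a = cong suc (count-insert (P? ∘ suc) (Q? ∘ suc) P⊆Q Qa ¬Pa (map₂ suc-injective ∘ Q⊆P+a))
... | no _  | no _  | suc a = count-insert (P? ∘ suc) (Q? ∘ suc) P⊆Q Qa ¬Pa (map₂ suc-injective ∘ Q⊆P+a)

count-all : {P : Pred (Fin n) 0ℓ} (P? : Decidable P) → (∀ x → P x) → count P? ≡ n
count-all {zero}  P? all = refl
count-all {suc n} P? all with P? zero
... | yes _ = cong suc (count-all (P? ∘ suc) (all ∘ suc))
... | no ¬p = contradiction (all zero) ¬p

count-none : {P : Pred (Fin n) 0ℓ} (P? : Decidable P) → (∀ x → ¬ P x) → count P? ≡ 0
count-none {zero}  P? none = refl
count-none {suc n} P? none with P? zero
... | yes p = contradiction p (none zero)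
... | no _  = count-none (P? ∘ suc) (none ∘ suc)

Moved : (Fin n → Fin n) → Pred (Fin n) 0ℓ
Moved π z = π z ≢ z

moved? : (π : Fin n → Fin n) → Decidable (Moved π)
moved? π z = ¬? (π z ≟ z)

moved-induction : (Goal : (Fin n → Fin n) → Set) →
  (∀ π → (∀ {π₀} → count (moved? π₀) < count (moved? π) → Goal π₀) → Goal π) → ∀ π → Goal π
moved-induction Goal = All.wfRec (wellFounded (count ∘ moved?) <-wellFounded) 0ℓ Goal

unmoved⇒fixed : {π : Fin n → Fin n} → ¬ ∃ (Moved π) → ∀ z → π z ≡ z
unmoved⇒fixed {π = π} unmoved z = decidable-stable (π z ≟ z) (curry unmoved z)

#cycles-id : {π : Fin n → Fin n} → (∀ z → π z ≡ z) → #cycles π ≡ n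
#cycles-id {π = π} fixed = numClasses-unique (cycles π) (numClasses-discrete λ { refl → sym (fixed _) })

module SplitOff {π : Fin n → Fin n} (π-inj : Injective _≡_ _≡_ π) {x : Fin n} (x-moved : Moved π x) where

  π₀ : Fin n → Fin n
  π₀ = π ∘ transpose x (π x)

  π₀-inj : Injective _≡_ _≡_ π₀
  π₀-inj = transpose-injective x (π x) ∘ π-inj

  π₀-fixes-πx : π₀ (π x) ≡ π x
  π₀-fixes-πx = cong π (transpose-j x (π x))

  π₀-elsewhere : ∀ {z} → z ≢ x → z ≢ π x → π₀ z ≡ π z
  π₀-elsewhere z≢x z≢πx = cong π (transpose-other x (π x) z≢x z≢πx)

  πx-moved : Moved π (π x)
  πx-moved = x-moved ∘ π-inj

  moved₀⊆moved : Moved π₀ ⊆ Moved π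
  moved₀⊆moved {z} z-moved₀ πz≡z = z-moved₀ (trans (π₀-elsewhere z≢x z≢πx) πz≡z)
    where
    z≢x : z ≢ x
    z≢x refl = x-moved πz≡z
    z≢πx : z ≢ π x
    z≢πx refl = πx-moved πz≡z

  count-moved₀ : count (moved? π₀) < count (moved? π)
  count-moved₀ = count-strict (moved? π₀) (moved? π) moved₀⊆moved πx-moved (λ moved → moved π₀-fixes-πx)

  #cycles-π₀ : #cycles π₀ ≡ suc (#cycles π)
  #cycles-π₀ = #cycles-transpose-merge (transpose-back {π′ = π₀} λ _ → refl) π₀-inj
    (λ x~πx → x-moved (sym (fixed-isolated π₀-inj π₀-fixes-πx x~πx)))

  module _ (π-inv : Involutive _≡_ π) where

    π₀-fixes-x : π₀ x ≡ x
    π₀-fixes-x = trans (cong π (transpose-i x (π x))) (π-inv x)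

    π₀-involutive : Involutive _≡_ π₀
    π₀-involutive z = at (z ≟ x) (z ≟ π x)
      where
      open ≡-Reasoning
      at : Dec (z ≡ x) → Dec (z ≡ π x) → π₀ (π₀ z) ≡ z
      at (yes refl) _          = trans (cong π₀ π₀-fixes-x) π₀-fixes-x
      at (no _)     (yes refl) = trans (cong π₀ π₀-fixes-πx) π₀-fixes-πx
      at (no z≢x)   (no z≢πx)  = begin
        π₀ (π₀ z) ≡⟨ cong π₀ (π₀-elsewhere z≢x z≢πx) ⟩
        π₀ (π z)  ≡⟨ π₀-elsewhere (λ πz≡x → z≢πx (trans (sym (π-inv z)) (cong π πz≡x))) (z≢x ∘ π-inj) ⟩
        π (π z)   ≡⟨ π-inv z ⟩
        z         ∎

    count-moved-involution : count (moved? π) ≡ 2 + count (moved? π₀)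
    count-moved-involution = trans
      (count-insert moved₁? (moved? π) [ moved₀⊆moved , (λ { refl → πx-moved }) ]′ x-moved
        [ (λ moved → moved π₀-fixes-x) , x-moved ∘ sym ]′ split-x)
      (cong suc (count-insert (moved? π₀) moved₁? inj₁ (inj₂ refl) (λ moved → moved π₀-fixes-πx) id))
      where
      moved₁? : Decidable (λ z → Moved π₀ z ⊎ z ≡ π x)
      moved₁? z = moved? π₀ z ⊎-dec (z ≟ π x)
      split-x : ∀ {z} → Moved π z → (Moved π₀ z ⊎ z ≡ π x) ⊎ z ≡ x
      split-x {z} z-moved = at (z ≟ x) (z ≟ π x)
        where
        at : Dec (z ≡ x) → Dec (z ≡ π x) → (Moved π₀ z ⊎ z ≡ π x) ⊎ z ≡ x
        at (yes z≡x) _          = inj₂ z≡x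
        at (no _)    (yes z≡πx) = inj₁ (inj₂ z≡πx)
        at (no z≢x)  (no z≢πx)  = inj₁ (inj₁ (z-moved ∘ trans (sym (π₀-elsewhere z≢x z≢πx))))

#cycles-involution : (π : Fin n → Fin n) → Involutive _≡_ π →
  #cycles π + #cycles π + count (moved? π) ≡ n + n
#cycles-involution {n} = moved-induction Formula step
  where
  Formula : (Fin n → Fin n) → Set
  Formula π = Involutive _≡_ π → #cycles π + #cycles π + count (moved? π) ≡ n + n
  step : ∀ π → (∀ {π₀} → count (moved? π₀) < count (moved? π) → Formula π₀) → Formula π
  step π ih π-inv with any? (moved? π)
  ... | no unmoved = begin
    #cycles π + #cycles π + count (moved? π)
      ≡⟨ cong₂ (λ c m → c + c + m) (#cycles-id (unmoved⇒fixed unmoved))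
               (count-none (moved? π) (curry unmoved)) ⟩
    n + n + 0
      ≡⟨ +-identityʳ (n + n) ⟩
    n + n ∎
    where open ≡-Reasoning
  ... | yes (x , x-moved) = begin
    #cycles π + #cycles π + count (moved? π)
      ≡⟨ cong (#cycles π + #cycles π +_) (count-moved-involution π-inv) ⟩
    #cycles π + #cycles π + (2 + count (moved? π₀))
      ≡⟨ solve 2 (λ c m → c :+ c :+ (con 2 :+ m) := (con 1 :+ c) :+ (con 1 :+ c) :+ m) refl _ _ ⟩
    suc (#cycles π) + suc (#cycles π) + count (moved? π₀)
      ≡⟨ cong (λ c → c + c + count (moved? π₀)) #cycles-π₀ ⟨
    #cycles π₀ + #cycles π₀ + count (moved? π₀)
      ≡⟨ ih count-moved₀ (π₀-involutive π-inv) ⟩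
    n + n ∎
    where
    open ≡-Reasoning
    open SplitOff (involutive⇒injective {f = π} π-inv) x-moved

FixedPointFree : (X → X) → Set
FixedPointFree f = ∀ x → f x ≢ x

#cycles-fixedPointFree : {α : Fin n → Fin n} → Involutive _≡_ α → FixedPointFree α →
  #cycles α + #cycles α ≡ n
#cycles-fixedPointFree {n} {α} α-inv α-fpf = +-cancelʳ-≡ n _ _ (begin
  #cycles α + #cycles α + n                  ≡⟨ cong (#cycles α + #cycles α +_) (count-all (moved? α) α-fpf) ⟨
  #cycles α + #cycles α + count (moved? α)   ≡⟨ #cycles-involution α α-inv ⟩
  n + n                                      ∎)
  where open ≡-Reasoning

2∣n+n : ∀ n → 2 ∣ n + n
2∣n+n n = divides n (trans (cong (n +_) (sym (+-identityʳ n))) (*-comm 2 n))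

module _ {ι : Fin n → Fin n} (ι-inv : Involutive _≡_ ι) (ι-fpf : FixedPointFree ι)
         {S : Pred (Fin n) 0ℓ} (S? : Decidable S) (S-closed : ∀ {z} → S z → S (ι z)) where

  ι∣S : Fin n → Fin n
  ι∣S z with S? z
  ... | yes _ = ι z
  ... | no _  = z

  ι∣S-inside : ∀ {z} → S z → ι∣S z ≡ ι z
  ι∣S-inside {z} z∈S with S? z
  ... | yes _    = refl
  ... | no z∉S   = contradiction z∈S z∉S

  ι∣S-outside : ∀ {z} → ¬ S z → ι∣S z ≡ z
  ι∣S-outside {z} z∉S with S? z
  ... | yes z∈S = contradiction z∈S z∉S
  ... | no _    = refl

  ι∣S-involutive : Involutive _≡_ ι∣S
  ι∣S-involutive z = at (S? z)
    where
    at : Dec (S z) → ι∣S (ι∣S z) ≡ z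
    at (yes z∈S) = trans (cong ι∣S (ι∣S-inside z∈S)) (trans (ι∣S-inside (S-closed z∈S)) (ι-inv z))
    at (no z∉S)  = trans (cong ι∣S (ι∣S-outside z∉S)) (ι∣S-outside z∉S)

  moved-ι∣S⊆S : Moved ι∣S ⊆ S
  moved-ι∣S⊆S {z} z-moved = decidable-stable (S? z) (z-moved ∘ ι∣S-outside)

  invariant-even : 2 ∣ count S?
  invariant-even = ∣m+n∣m⇒∣n (subst (2 ∣_) (begin
    n + n
      ≡⟨ #cycles-involution ι∣S ι∣S-involutive ⟨
    #cycles ι∣S + #cycles ι∣S + count (moved? ι∣S)
      ≡⟨ cong (#cycles ι∣S + #cycles ι∣S +_) (count-cong (moved? ι∣S) S? moved-ι∣S⊆S S⊆moved) ⟩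
    #cycles ι∣S + #cycles ι∣S + count S? ∎) (2∣n+n n)) (2∣n+n (#cycles ι∣S))
    where
    open ≡-Reasoning
    S⊆moved : S ⊆ Moved ι∣S
    S⊆moved z∈S = ι-fpf _ ∘ trans (sym (ι∣S-inside z∈S))

2∤1+ : ∀ {m} → 2 ∣ m → ¬ 2 ∣ suc m
2∤1+ {m} 2∣m 2∣1+m with ∣1⇒≡1 (∣m+n∣m⇒∣n (subst (2 ∣_) (+-comm 1 m) 2∣1+m) 2∣m)
... | ()

module _ {α β : Fin n → Fin n} (α-inv : Involutive _≡_ α) (α-fpf : FixedPointFree α)
         (β-inv : Involutive _≡_ β) (β-fpf : FixedPointFree β) {a b : Fin n} where

  private
    β′ : Fin n → Fin n
    β′ = transpose a b ∘ β ∘ transpose a b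

  -- Otherwise the set Common of points joined to a in both graphs has an even number of
  -- elements, being closed under α, and so does Common ∖ {a}, being closed under β.
  splice-connects : ¬ EqClosure (Graph α ∪ Graph β′) a b → EqClosure (Graph α ∪ Graph β) a b
  splice-connects a≁′b with eqClosure? (orbits α β) a b
  ... | yes a~b = a~b
  ... | no a≁b  = ⊥-elim (2∤1+ (invariant-even β-inv β-fpf Common∖a? β-closed)
                              (subst (2 ∣_) count-Common (invariant-even α-inv α-fpf Common? α-closed)))
    where
    Common : Pred (Fin n) 0ℓ
    Common z = EqClosure (Graph α ∪ Graph β) a z × EqClosure (Graph α ∪ Graph β′) a z
    Common? : Decidable Common
    Common? z = eqClosure? (orbits α β) a z ×-dec eqClosure? (orbits α β′) a z
    Common∖a? : Decidable (λ z → Common z × z ≢ a)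
    Common∖a? z = Common? z ×-dec ¬? (z ≟ a)
    count-Common : count Common? ≡ suc (count Common∖a?)
    count-Common = count-insert Common∖a? Common? proj₁ (ε , ε) (λ a≢a → proj₂ a≢a refl) remove-a
      where
      remove-a : ∀ {z} → Common z → (Common z × z ≢ a) ⊎ z ≡ a
      remove-a {z} z∈Common with z ≟ a
      ... | yes z≡a = inj₂ z≡a
      ... | no z≢a  = inj₁ (z∈Common , z≢a)
    α-closed : ∀ {z} → Common z → Common (α z)
    α-closed (a~z , a~′z) = a~z ◅◅ return (inj₁ refl) , a~′z ◅◅ return (inj₁ refl)
    β-closed : ∀ {z} → Common z × z ≢ a → Common (β z) × β z ≢ a
    β-closed {z} ((a~z , a~′z) , z≢a) =
      (a~z ◅◅ return (inj₂ refl) , a~′z ◅◅ return (inj₂ β′z≡βz)) , βz≢a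
      where
      z≢b : z ≢ b
      z≢b refl = a≁b a~z
      β′z≡tβz : β′ z ≡ transpose a b (β z)
      β′z≡tβz = cong (transpose a b ∘ β) (transpose-other a b z≢a z≢b)
      βz≢a : β z ≢ a
      βz≢a βz≡a = a≁′b (a~′z ◅◅ return (inj₂ β′z≡b))
        where
        β′z≡b : β′ z ≡ b
        β′z≡b = trans β′z≡tβz (trans (cong (transpose a b) βz≡a) (transpose-i a b))
      βz≢b : β z ≢ b
      βz≢b βz≡b = a≁b (a~z ◅◅ return (inj₂ βz≡b))
      β′z≡βz : β′ z ≡ β z
      β′z≡βz = trans β′z≡tβz (transpose-other a b βz≢a βz≢b)

euler-inequality-id : {π α : Fin n → Fin n} → (∀ z → π z ≡ z) →
  #cycles π + #cycles (π ∘ α) + #cycles α ≤ n + (#orbits π α + #orbits π α)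
euler-inequality-id {n} {π} {α} fixed = ≤-reflexive (begin
  #cycles π + #cycles (π ∘ α) + #cycles α
    ≡⟨ cong₂ (λ c d → c + d + #cycles α) (#cycles-id fixed) (#cycles-cong (fixed ∘ α)) ⟩
  n + #cycles α + #cycles α
    ≡⟨ +-assoc n _ _ ⟩
  n + (#cycles α + #cycles α)
    ≡⟨ cong (λ k → n + (k + k)) #orbits≡#cycles-α ⟨
  n + (#orbits π α + #orbits π α) ∎)
  where
  open ≡-Reasoning
  orbits⇒α : Graph π ∪ Graph α ⇒ EqClosure (Graph α)
  orbits⇒α (inj₁ refl) = subst (EqClosure (Graph α) _) (sym (fixed _)) ε
  orbits⇒α (inj₂ e)    = return e
  #orbits≡#cycles-α : #orbits π α ≡ #cycles α
  #orbits≡#cycles-α = numClasses-≡ orbits⇒α (return ∘ inj₂) (orbits π α) (cycles α)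

module _ {π α : Fin n → Fin n} (π-inj : Injective _≡_ _≡_ π) (α-inv : Involutive _≡_ α)
         {x : Fin n} (x-moved : Moved π x) where

  open SplitOff π-inj x-moved

  private
    π≗π₀τ : π ≗ π₀ ∘ transpose x (π x)
    π≗π₀τ = transpose-back {π′ = π₀} (λ _ → refl)

    π₀α≗παατ : π₀ ∘ α ≗ (π ∘ α) ∘ transpose (α x) (α (π x))
    π₀α≗παατ z = cong π (transpose-∘-involution {α = α} α-inv x (π x) z)

    πα≗π₀αατ : π ∘ α ≗ (π₀ ∘ α) ∘ transpose (α x) (α (π x))
    πα≗π₀αατ = transpose-back π₀α≗παατ

    widen : Graph π ∪ Graph α ⇒ EqClosure (Edge x (π x) ∪ (Graph π₀ ∪ Graph α))
    widen = orbits-transpose π≗π₀τ α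

    narrow : Edge x (π x) ∪ (Graph π₀ ∪ Graph α) ⇒ EqClosure (Graph π ∪ Graph α)
    narrow (inj₁ refl) = return (inj₁ refl)
    narrow (inj₂ e)    = (absorbEdge (return (inj₁ refl)) ⋆) (orbits-transpose {π′ = π₀} (λ _ → refl) α e)

    π₀α⇒orbits : Graph (π₀ ∘ α) ⇒ EqClosure (Graph π₀ ∪ Graph α)
    π₀α⇒orbits refl = return (inj₂ refl) ◅◅ return (inj₁ refl)

  -- Turning π x into a fixed point adds a vertex; it also adds a face if it disconnects
  -- the map, and otherwise removes at most one.
  euler-inequality-step :
    #cycles π₀ + #cycles (π₀ ∘ α) + #cycles α ≤ n + (#orbits π₀ α + #orbits π₀ α) →
    #cycles π + #cycles (π ∘ α) + #cycles α ≤ n + (#orbits π α + #orbits π α)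
  euler-inequality-step ih with eqClosure? (orbits π₀ α) x (π x)
  ... | yes x~πx = begin
    #cycles π + #cycles (π ∘ α) + #cycles α
      ≤⟨ +-monoˡ-≤ (#cycles α) (+-monoʳ-≤ (#cycles π) (#cycles-transpose-≤ π₀α≗παατ)) ⟩
    #cycles π + suc (#cycles (π₀ ∘ α)) + #cycles α
      ≡⟨ cong (λ c → c + #cycles α) (+-suc (#cycles π) _) ⟩
    suc (#cycles π) + #cycles (π₀ ∘ α) + #cycles α
      ≡⟨ cong (λ c → c + #cycles (π₀ ∘ α) + #cycles α) #cycles-π₀ ⟨
    #cycles π₀ + #cycles (π₀ ∘ α) + #cycles α
      ≤⟨ ih ⟩
    n + (#orbits π₀ α + #orbits π₀ α)
      ≡⟨ cong (λ k → n + (k + k)) same-orbits ⟩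
    n + (#orbits π α + #orbits π α) ∎
    where
    open ≤-Reasoning
    same-orbits : #orbits π₀ α ≡ #orbits π α
    same-orbits = numClasses-≡ narrow widen (numClasses-addEdge (orbits π₀ α) x~πx) (orbits π α)
  ... | no x≁πx with numClasses-addEdge-merging (orbits π₀ α) x≁πx
  ...   | k , #orbits₀≡1+k , N = ≤-pred (≤-pred (begin
    suc (suc (#cycles π + #cycles (π ∘ α) + #cycles α))
      ≡⟨ solve 3 (λ c d e → con 2 :+ (c :+ d :+ e) := (con 1 :+ c) :+ (con 1 :+ d) :+ e) refl (#cycles π) (#cycles (π ∘ α)) (#cycles α) ⟩
    suc (#cycles π) + suc (#cycles (π ∘ α)) + #cycles α
      ≡⟨ cong₂ (λ c d → c + d + #cycles α) #cycles-π₀ #cycles-π₀α ⟨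
    #cycles π₀ + #cycles (π₀ ∘ α) + #cycles α
      ≤⟨ ih ⟩
    n + (#orbits π₀ α + #orbits π₀ α)
      ≡⟨ cong (λ k → n + (k + k)) (trans #orbits₀≡1+k (cong suc k≡#orbits)) ⟩
    n + (suc (#orbits π α) + suc (#orbits π α))
      ≡⟨ solve 2 (λ m k → m :+ ((con 1 :+ k) :+ (con 1 :+ k)) := con 2 :+ (m :+ (k :+ k))) refl _ _ ⟩
    suc (suc (n + (#orbits π α + #orbits π α))) ∎))
    where
    open ≤-Reasoning
    k≡#orbits : k ≡ #orbits π α
    k≡#orbits = numClasses-≡ narrow widen N (orbits π α)
    αx≁απx : ¬ EqClosure (Graph (π₀ ∘ α)) (α x) (α (π x))
    αx≁απx αx~απx = x≁πx (return (inj₂ refl) ◅◅ (π₀α⇒orbits ⋆) αx~απx ◅◅ return (inj₂ (α-inv (π x))))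
    #cycles-π₀α : #cycles (π₀ ∘ α) ≡ suc (#cycles (π ∘ α))
    #cycles-π₀α = #cycles-transpose-merge πα≗π₀αατ (involutive⇒injective {f = α} α-inv ∘ π₀-inj) αx≁απx

euler-inequality : (π α : Fin n → Fin n) → Injective _≡_ _≡_ π → Involutive _≡_ α →
  #cycles π + #cycles (π ∘ α) + #cycles α ≤ n + (#orbits π α + #orbits π α)
euler-inequality {n} π α π-inj α-inv = moved-induction Inequality step π π-inj
  where
  Inequality : (Fin n → Fin n) → Set
  Inequality π = Injective _≡_ _≡_ π →
    #cycles π + #cycles (π ∘ α) + #cycles α ≤ n + (#orbits π α + #orbits π α)
  step : ∀ π → (∀ {π₀} → count (moved? π₀) < count (moved? π) → Inequality π₀) → Inequality π
  step π ih π-inj with any? (moved? π)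
  ... | no unmoved        = euler-inequality-id (unmoved⇒fixed unmoved)
  ... | yes (x , x-moved) = euler-inequality-step π-inj α-inv x-moved (ih count-moved₀ π₀-inj)
    where open SplitOff π-inj x-moved

Dart : CMap → Set
Dart M = Fin (CMap.n M)

module _ (M : CMap) where

  σ⁺σ⁻ : ∀ d → σ⁺ M (σ⁻ M d) ≡ d
  σ⁺σ⁻ d = inverseʳ (σ M)

  σ⁻σ⁺ : ∀ d → σ⁻ M (σ⁺ M d) ≡ d
  σ⁻σ⁺ d = inverseˡ (σ M)

  σ⁺-injective : Injective _≡_ _≡_ (σ⁺ M)
  σ⁺-injective {d} {e} σd≡σe = trans (sym (σ⁻σ⁺ d)) (trans (cong (σ⁻ M) σd≡σe) (σ⁻σ⁺ e))

  φ-injective : Injective _≡_ _≡_ (φ M)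
  φ-injective = involutive⇒injective {f = α M} (α-inv M) ∘ σ⁺-injective

  β : Dart M → Dart M
  β = σ⁺ M ∘ α M ∘ σ⁻ M

  β-involutive : Involutive _≡_ β
  β-involutive c = begin
    σ⁺ M (α M (σ⁻ M (σ⁺ M (α M (σ⁻ M c))))) ≡⟨ cong (σ⁺ M ∘ α M) (σ⁻σ⁺ _) ⟩
    σ⁺ M (α M (α M (σ⁻ M c)))               ≡⟨ cong (σ⁺ M) (α-inv M _) ⟩
    σ⁺ M (σ⁻ M c)                           ≡⟨ σ⁺σ⁻ c ⟩
    c                                       ∎
    where open ≡-Reasoning

  β-fixedPointFree : FixedPointFree β
  β-fixedPointFree c βc≡c = α-fpf M (σ⁻ M c) (σ⁺-injective (trans βc≡c (sym (σ⁺σ⁻ c))))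

  -- Across the edge {d, α d} the angles at d and α d are adjacent, and so are those at
  -- σ d and σ (α d) = β (σ d).
  CornerGraph : Rel (Dart M) 0ℓ
  CornerGraph = Graph (α M) ∪ Graph β

euler-excess : ∀ V E F N → V + F ≡ E + 2 → E + E ≡ N → suc V + suc F + E ≰ N + (1 + 1)
euler-excess V E F N V+F≡E+2 E+E≡N ≤N+2 = <⇒≱ (+-monoʳ-< N (s≤s (s≤s z<s))) (begin
  N + 4                ≡⟨ +-comm N 4 ⟩
  4 + N                ≡⟨ cong (4 +_) E+E≡N ⟨
  4 + (E + E)          ≡⟨ solve 1 (λ e → con 4 :+ (e :+ e) := con 2 :+ (e :+ con 2) :+ e) refl E ⟩
  2 + (E + 2) + E      ≡⟨ cong (λ s → 2 + s + E) V+F≡E+2 ⟨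
  2 + (V + F) + E      ≡⟨ cong (_+ E) (solve 2 (λ v f → con 2 :+ (v :+ f) := (con 1 :+ v) :+ (con 1 :+ f)) refl _ _) ⟩
  suc V + suc F + E    ≤⟨ ≤N+2 ⟩
  N + 2                ∎)
  where open ≤-Reasoning

module SplitVertex {M : CMap} (connected : Connected M) (plane : Plane M)
                   {a b : Dart M} (a≢b : a ≢ b) (a~ᵥb : SameVertex M a b) (a~fb : SameFace M a b) where

  x y : Dart M
  x = σ⁻ M a
  y = σ⁻ M b

  σ′ : Dart M → Dart M
  σ′ = σ⁺ M ∘ transpose x y

  x≢y : x ≢ y
  x≢y x≡y = a≢b (trans (sym (σ⁺σ⁻ M a)) (trans (cong (σ⁺ M) x≡y) (σ⁺σ⁻ M b)))

  x~ᵥy : SameVertex M x y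
  x~ᵥy = sameOrbit-trans _ (1 , σ⁺σ⁻ M a)
           (sameOrbit-trans _ a~ᵥb (sameOrbit-sym (σ⁺-injective M) (1 , σ⁺σ⁻ M b)))

  αx~fαy : SameFace M (α M x) (α M y)
  αx~fαy = sameOrbit-trans _ (1 , φαx≡a)
             (sameOrbit-trans _ a~fb (sameOrbit-sym (φ-injective M) (1 , φαy≡b)))
    where
    φαx≡a : φ M (α M x) ≡ a
    φαx≡a = trans (cong (σ⁺ M) (α-inv M x)) (σ⁺σ⁻ M a)
    φαy≡b : φ M (α M y) ≡ b
    φαy≡b = trans (cong (σ⁺ M) (α-inv M y)) (σ⁺σ⁻ M b)

  #cycles-σ′ : #cycles σ′ ≡ suc (#cycles (σ⁺ M))
  #cycles-σ′ = #cycles-transpose-split (λ _ → refl) (σ⁺-injective M) x~ᵥy x≢y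

  #cycles-σ′α : #cycles (σ′ ∘ α M) ≡ suc (#cycles (φ M))
  #cycles-σ′α = #cycles-transpose-split (λ z → cong (σ⁺ M) (transpose-∘-involution {α = α M} (α-inv M) x y z))
    (φ-injective M) αx~fαy (x≢y ∘ involutive⇒injective {f = α M} (α-inv M))

  -- Splitting the vertex of a and b while keeping the map connected would create
  -- a vertex and a face without a new edge, against Euler's formula.
  x≁y : ¬ EqClosure (Graph σ′ ∪ Graph (α M)) x y
  x≁y x~y = euler-excess V E F (CMap.n M) (plane V E F (cycles _) (cycles _) (cycles _))
    (#cycles-fixedPointFree (α-inv M) (α-fpf M)) (begin
      suc V + suc F + E                              ≡⟨ cong₂ (λ c d → c + d + E) #cycles-σ′ #cycles-σ′α ⟨
      #cycles σ′ + #cycles (σ′ ∘ α M) + E             ≤⟨ euler-inequality σ′ (α M) σ′-injective (α-inv M) ⟩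
      CMap.n M + (#orbits σ′ (α M) + #orbits σ′ (α M)) ≡⟨ cong (λ k → CMap.n M + (k + k)) single-orbit ⟩
      CMap.n M + (1 + 1)                              ∎)
    where
    open ≤-Reasoning
    V E F : ℕ
    V = #cycles (σ⁺ M)
    E = #cycles (α M)
    F = #cycles (φ M)
    σ′-injective : Injective _≡_ _≡_ σ′
    σ′-injective = transpose-injective x y ∘ σ⁺-injective M
    old⇒new : Graph (σ⁺ M) ∪ Graph (α M) ⇒ EqClosure (Graph σ′ ∪ Graph (α M))
    old⇒new = (absorbEdge x~y ⋆) ∘ orbits-transpose (transpose-back {π′ = σ′} λ _ → refl) (α M)
    new⇒old : Graph σ′ ∪ Graph (α M) ⇒ EqClosure (Graph (σ⁺ M) ∪ Graph (α M))
    new⇒old = (absorbEdge (EqClosure.map inj₁ (sameOrbit⇒eqClosure _ x~ᵥy)) ⋆)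
              ∘ orbits-transpose (λ _ → refl) (α M)
    single-orbit : #orbits σ′ (α M) ≡ 1
    single-orbit = sym (numClasses-≡ old⇒new new⇒old connected (orbits σ′ (α M)))

  σ′≗τσ : σ′ ≗ transpose a b ∘ σ⁺ M
  σ′≗τσ z = sym (subst₂ (λ p q → transpose p q (σ⁺ M z) ≡ σ′ z) (σ⁺σ⁻ M a) (σ⁺σ⁻ M b)
    (transpose-conjugate (σ⁺-injective M) x y z))

  β′ : Dart M → Dart M
  β′ = transpose a b ∘ β M ∘ transpose a b

  -- β′ = σ′ α σ′⁻¹
  β′⇒split : Graph (α M) ∪ Graph β′ ⇒ EqClosure (Graph σ′ ∪ Graph (α M))
  β′⇒split (inj₁ e) = return (inj₂ e)
  β′⇒split {p} (inj₂ refl) =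
    symmetric _ (return (inj₁ σ′w≡p)) ◅◅ return (inj₂ refl) ◅◅ return (inj₁ (σ′≗τσ _))
    where
    w = σ⁻ M (transpose a b p)
    σ′w≡p : σ′ w ≡ p
    σ′w≡p = trans (σ′≗τσ w) (trans (cong (transpose a b) (σ⁺σ⁻ M _)) (transpose-involutive a b p))

  a≁′b : ¬ EqClosure (Graph (α M) ∪ Graph β′) a b
  a≁′b a~′b =
    x≁y (return (inj₁ σ′x≡b) ◅◅ symmetric _ ((β′⇒split ⋆) a~′b) ◅◅ symmetric _ (return (inj₁ σ′y≡a)))
    where
    σ′x≡b : σ′ x ≡ b
    σ′x≡b = trans (cong (σ⁺ M) (transpose-i x y)) (σ⁺σ⁻ M b)
    σ′y≡a : σ′ y ≡ a
    σ′y≡a = trans (cong (σ⁺ M) (transpose-j x y)) (σ⁺σ⁻ M a)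

sameAngle⇒cornerConnected : (M : CMap) → Connected M → Plane M →
  ∀ {a b} → SameAngle M a b → EqClosure (CornerGraph M) a b
sameAngle⇒cornerConnected M connected plane {a} {b} (a~ᵥb , a~fb) with a ≟ b
... | yes refl = ε
... | no a≢b   = splice-connects (α-inv M) (α-fpf M) (β-involutive M) (β-fixedPointFree M) a≁′b
  where open SplitVertex {M} connected plane a≢b a~ᵥb a~fb

module _ (M : CMap) where

  φφ⁻ : ∀ d → φ M (φ⁻ M d) ≡ d
  φφ⁻ d = trans (cong (σ⁺ M) (α-inv M _)) (σ⁺σ⁻ M d)

  φ⁻φ : ∀ d → φ⁻ M (φ M d) ≡ d
  φ⁻φ d = trans (cong (α M) (σ⁻σ⁺ M _)) (α-inv M d)

  -- The medial edge d passes through the angle of G at the dart φ d.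
  medialAngle : MedialDart M → Dart M
  medialAngle (d , _) = φ M d

  angleMedial : Dart M → MedialDart M
  angleMedial c = φ⁻ M c , false

  private
    SA : Rel (MedialDart M) 0ℓ
    SA = StraightAhead (medialGraph M)

  straightAhead⇒corner : SA ⇒ (EqClosure (CornerGraph M) on medialAngle)
  straightAhead⇒corner (inj₂ refl)             = ε
  straightAhead⇒corner {d , false} (inj₁ refl) = return (inj₁ (sym (φφ⁻ _)))
  straightAhead⇒corner {d , true}  (inj₁ refl) = return (inj₂ (begin
    σ⁺ M (α M (σ⁻ M (σ⁺ M (α M d)))) ≡⟨ cong (σ⁺ M ∘ α M) (σ⁻σ⁺ M (α M d)) ⟩
    φ M (α M d)                      ≡⟨ cong (φ M) (φφ⁻ (α M d)) ⟨
    φ M (φ M (φ⁻ M (α M d)))         ∎))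
    where open ≡-Reasoning

  private
    φφ⁻αφ⁻≡σ⁻ : ∀ c → φ M (φ⁻ M (α M (φ⁻ M c))) ≡ σ⁻ M c
    φφ⁻αφ⁻≡σ⁻ c = trans (φφ⁻ _) (α-inv M _)

    φ⁻β≡σ⁻ : ∀ c → φ⁻ M (β M c) ≡ σ⁻ M c
    φ⁻β≡σ⁻ c = trans (cong (α M) (σ⁻σ⁺ M _)) (α-inv M _)

  corner⇒straightAhead : CornerGraph M ⇒ (EqClosure SA on angleMedial)
  corner⇒straightAhead {c} (inj₁ refl) =
    subst (λ t → EqClosure SA (angleMedial c) (φ⁻ M (α M t) , false)) (φφ⁻ c)
      (return (inj₁ refl) ◅◅ return (inj₂ refl))
  corner⇒straightAhead {c} (inj₂ refl) =
    subst (λ t → EqClosure SA (angleMedial c) (t , false)) (trans (φφ⁻αφ⁻≡σ⁻ c) (sym (φ⁻β≡σ⁻ c)))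
      (return (inj₂ refl) ◅◅ return (inj₁ refl))

  medial~angleMedial : ∀ u → EqClosure SA u (angleMedial (medialAngle u))
  medial~angleMedial (d , false) = subst (λ t → EqClosure SA (d , false) (t , false)) (sym (φ⁻φ d)) ε
  medial~angleMedial (d , true)  = return (inj₂ refl) ◅◅ medial~angleMedial (d , false)

  straightAhead⇔corner : ∀ u v →
    EqClosure SA u v ⇔ EqClosure (CornerGraph M) (medialAngle u) (medialAngle v)
  straightAhead⇔corner u v = mk⇔ (gfold (EqClosure.isEquivalence _) medialAngle straightAhead⇒corner)
    (λ u~v → medial~angleMedial u ◅◅ gfold (EqClosure.isEquivalence _) angleMedial corner⇒straightAhead u~v
             ◅◅ symmetric _ (medial~angleMedial v))

AngleGraph : (M : CMap) → Rel (Dart M) 0ℓ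
AngleGraph M a b = SameAngle M a b ⊎ AdjacentAngles M a b

module _ (M : CMap) where

  corner⇒angle : CornerGraph M ⇒ EqClosure (AngleGraph M)
  corner⇒angle {c} (inj₁ e) = return (inj₂ (c , (0 , refl) , (0 , e) , inj₁ ((0 , refl) , (0 , e))))
  corner⇒angle {c} (inj₂ e) =
    return (inj₂ (σ⁻ M c , (1 , σ⁺σ⁻ M c) , (1 , e) , inj₂ ((1 , φασ⁻c≡c) , (1 , e))))
    where
    φασ⁻c≡c : φ M (α M (σ⁻ M c)) ≡ c
    φασ⁻c≡c = trans (cong (σ⁺ M) (α-inv M _)) (σ⁺σ⁻ M c)

  angle⇒corner : Connected M → Plane M → AngleGraph M ⇒ EqClosure (CornerGraph M)
  angle⇒corner connected plane (inj₁ a≈b) = sameAngle⇒cornerConnected M connected plane a≈b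
  angle⇒corner connected plane (inj₂ (d , d~ᵥa , αd~ᵥb , inj₁ (d~fa , αd~fb))) =
    symmetric _ (sameAngle⇒cornerConnected M connected plane (d~ᵥa , d~fa)) ◅◅ return (inj₁ refl) ◅◅
    sameAngle⇒cornerConnected M connected plane (αd~ᵥb , αd~fb)
  angle⇒corner connected plane (inj₂ (d , d~ᵥa , αd~ᵥb , inj₂ (αd~fa , d~fb))) =
    symmetric _ (sameAngle⇒cornerConnected M connected plane (σd~ᵥa , σd~fa)) ◅◅
    return (inj₂ (cong (σ⁺ M ∘ α M) (σ⁻σ⁺ M d))) ◅◅
    sameAngle⇒cornerConnected M connected plane (σαd~ᵥb , σαd~fb)
    where
    σd~ᵥa : SameVertex M (σ⁺ M d) _
    σd~ᵥa = sameOrbit-shift (σ⁺-injective M) d~ᵥa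
    σd~fa : SameFace M (σ⁺ M d) _
    σd~fa = subst (λ t → SameFace M (σ⁺ M t) _) (α-inv M d) (sameOrbit-shift (φ-injective M) αd~fa)
    σαd~ᵥb : SameVertex M (σ⁺ M (α M d)) _
    σαd~ᵥb = sameOrbit-shift (σ⁺-injective M) αd~ᵥb
    σαd~fb : SameFace M (σ⁺ M (α M d)) _
    σαd~fb = sameOrbit-shift (φ-injective M) d~fb

  corner⇔angle : Connected M → Plane M →
    ∀ {a b} → EqClosure (CornerGraph M) a b ⇔ EqClosure (AngleGraph M) a b
  corner⇔angle connected plane = mk⇔ (corner⇒angle ⋆) (angle⇒corner connected plane ⋆)

proposition5 : (G : CMap) → Connected G → Plane G → Simple G →
    (k : ℕ) → #StraightAheadCircuits (medialGraph G) k ⇔ #AngleComponents G k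
proposition5 G connected plane _ = numClasses-transfer (medialAngle G) (angleMedial G) (φφ⁻ G)
  λ u v → corner⇔angle G connected plane ⇔-∘ straightAhead⇔corner G u v
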